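{- Let $n\ge 1$. Snort played on each of the following (initially uncoloured, untinted) graphs is a first player win: $T_{n,3}$; and the graphs obtained from $T_{n,3}$ by adding new vertices and edges as follows: (a) vertices $L_1,R_2,R_3$ with edges $L_1\sim(1,1)$, $L_1\sim(1,2)$, $(n,1)\sim R_2$, $(n,2)\sim R_2$, $(n,2)\sim R_3$, $(n,3)\sim R_3$, $R_2\sim R_3$; (b) vertices $L_1,R_3$ with edges $L_1\sim(1,1)$, $L_1\sim(1,2)$, $(n,2)\sim R_3$, $(n,3)\sim R_3$; (c) vertices $L_1,L_2,R_2,R_3$ with edges $L_1\sim(1,1)$, $L_1\sim(1,2)$, $L_2\sim(1,2)$, $L_2\sim(1,3)$, $L_1\sim L_2$, $(n,1)\sim R_2$, $(n,2)\sim R_2$, $(n,2)\sim R_3$, $(n,3)\sim R_3$, $R_2\sim R_3$; (d) vertices $R_2,R_3,R_3'$ with edges $(n,1)\sim R_2$, $(n,2)\sim R_2$, $(n,2)\sim R_3$, $(n,3)\sim R_3$, $R_2\sim R_3$, $R_2\sim R_3'$, $R_3\sim R_3'$; (e) vertex $R_3$ with edges $(n,2)\sim R_3$, $(n,3)\sim R_3$; (f) when $n$ is even: vertices $R_2,R_3$ with edges $(n,1)\sim R_2$, $(n,2)\sim R_2$, $(n,2)\sim R_3$, $(n,3)\sim R_3$, $R_2\sim R_3$.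
   Context: Snort is a two-player game (players Left and Right) played on a finite simple graph. The players alternately colour a previously uncoloured vertex, Left in blue and Right in red, subject to the rule that no two adjacent vertices may receive opposite colours. Normal play: a player who cannot move on their turn loses. A game is a "first player win" if the player who moves first has a winning strategy, regardless of whether that player is Left or Right. $T_{n,3}$ is the graph with vertex set $\{(i,j): 1\le i\le n,\ 1\le j\le 3\}$ and edges $(i,j)\sim(i+1,j)$ for $1\le i\le n-1$, $1\le j\le 3$; $(i,j)\sim(i,j+1)$ for $1\le i\le n$, $1\le j\le 2$; and $(i,j)\sim(i+1,j+1)$ for $1\le i\le n-1$, $1\le j\le 2$. -}

module Defs where

open import Data.Nat using (ℕ; zero; suc)
open import Data.Fin using (Fin; zero; suc; toℕ; fromℕ)
open import Data.Product using (_×_; _,_)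
open import Data.Sum using (_⊎_; inj₁; inj₂)
open import Data.Empty using (⊥)
open import Data.Unit using (⊤)
open import Data.List using (List; []; _∷_)
open import Data.List.Membership.Propositional using (_∉_)
open import Relation.Binary.PropositionalEquality using (_≡_)

record Graph : Set₁ where
  field
    V    : Set
    Edge : V → V → Set

  Adj : V → V → Set
  Adj u v = Edge u v ⊎ Edge v u

open Graph public

data Player : Set where
  left right : Player

opp : Player → Player
opp left  = right
opp right = left

module Snort (G : Graph) where

  -- A position is the list of moves made so far: (v , p) means vertex v
  -- has been coloured by player p (Left = blue, Right = red).
  Position : Set
  Position = List (V G × Player)

  Legal : Player → Position → V G → Set
  Legal p pos v = (∀ q → (v , q) ∉ pos)
                × (∀ u → Adj G u v → (u , opp p) ∉ pos)

  -- Normal play: `Wins p pos` : player p, to move in pos, has a winning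
  -- strategy; `Loses p pos` : every move of p (possibly none) leads to a
  -- position where the opponent, to move, has a winning strategy.
  data Wins (p : Player) (pos : Position) : Set
  data Loses (p : Player) (pos : Position) : Set

  data Wins p pos where
    win : (v : V G) → Legal p pos v → Loses (opp p) ((v , p) ∷ pos) → Wins p pos

  data Loses p pos where
    lose : (∀ v → Legal p pos v → Wins (opp p) ((v , p) ∷ pos)) → Loses p pos

  FirstPlayerWin : Set
  FirstPlayerWin = Wins left [] × Wins right []

FirstPlayerWin : Graph → Set
FirstPlayerWin G = Snort.FirstPlayerWin G

-- T_{n,3}, with n = suc m; vertex (i , j) : Fin n × Fin 3 stands for the
-- paper's (i+1 , j+1).

Grid : ℕ → Set
Grid n = Fin n × Fin 3

GridEdge : ∀ {n} → Grid n → Grid n → Set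
GridEdge (i , j) (i' , j') =
    (toℕ i' ≡ suc (toℕ i) × j' ≡ j)
  ⊎ (i' ≡ i × toℕ j' ≡ suc (toℕ j))
  ⊎ (toℕ i' ≡ suc (toℕ i) × toℕ j' ≡ suc (toℕ j))

Extend : (n : ℕ) (X : Set) → (X → Grid n → Set) → (X → X → Set) → Graph
Extend n X XG XX = record { V = Grid n ⊎ X ; Edge = E }
  where
  E : Grid n ⊎ X → Grid n ⊎ X → Set
  E (inj₁ a) (inj₁ b) = GridEdge a b
  E (inj₁ a) (inj₂ y) = ⊥
  E (inj₂ x) (inj₁ b) = XG x b
  E (inj₂ x) (inj₂ y) = XX x y

T3 : ℕ → Graph
T3 n = record { V = Grid n ; Edge = GridEdge }

first : ∀ {m} → Fin 3 → Grid (suc m)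
first j = zero , j

last : ∀ {m} → Fin 3 → Grid (suc m)
last {m} j = fromℕ m , j

c1 c2 c3 : Fin 3
c1 = zero
c2 = suc zero
c3 = suc (suc zero)

data XA : Set where L1 R2 R3 : XA

GA : (m : ℕ) → Graph
GA m = Extend (suc m) XA xg xx
  where
  xg : XA → Grid (suc m) → Set
  xg L1 v = v ≡ first c1 ⊎ v ≡ first c2
  xg R2 v = v ≡ last c1 ⊎ v ≡ last c2
  xg R3 v = v ≡ last c2 ⊎ v ≡ last c3
  xx : XA → XA → Set
  xx R2 R3 = ⊤
  xx _  _  = ⊥

data XB : Set where L1 R3 : XB

GB : (m : ℕ) → Graph
GB m = Extend (suc m) XB xg (λ _ _ → ⊥)
  where
  xg : XB → Grid (suc m) → Set
  xg L1 v = v ≡ first c1 ⊎ v ≡ first c2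
  xg R3 v = v ≡ last c2 ⊎ v ≡ last c3

data XC : Set where L1 L2 R2 R3 : XC

GC : (m : ℕ) → Graph
GC m = Extend (suc m) XC xg xx
  where
  xg : XC → Grid (suc m) → Set
  xg L1 v = v ≡ first c1 ⊎ v ≡ first c2
  xg L2 v = v ≡ first c2 ⊎ v ≡ first c3
  xg R2 v = v ≡ last c1 ⊎ v ≡ last c2
  xg R3 v = v ≡ last c2 ⊎ v ≡ last c3
  xx : XC → XC → Set
  xx L1 L2 = ⊤
  xx R2 R3 = ⊤
  xx _  _  = ⊥

data XD : Set where R2 R3 R3' : XD

GD : (m : ℕ) → Graph
GD m = Extend (suc m) XD xg xx
  where
  xg : XD → Grid (suc m) → Set
  xg R2  v = v ≡ last c1 ⊎ v ≡ last c2
  xg R3  v = v ≡ last c2 ⊎ v ≡ last c3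
  xg R3' v = ⊥
  xx : XD → XD → Set
  xx R2 R3  = ⊤
  xx R2 R3' = ⊤
  xx R3 R3' = ⊤
  xx _  _   = ⊥

data XE : Set where R3 : XE

GE : (m : ℕ) → Graph
GE m = Extend (suc m) XE xg (λ _ _ → ⊥)
  where
  xg : XE → Grid (suc m) → Set
  xg R3 v = v ≡ last c2 ⊎ v ≡ last c3

data XF : Set where R2 R3 : XF

GF : (m : ℕ) → Graph
GF m = Extend (suc m) XF xg xx
  where
  xg : XF → Grid (suc m) → Set
  xg R2 v = v ≡ last c1 ⊎ v ≡ last c2
  xg R3 v = v ≡ last c2 ⊎ v ≡ last c3
  xx : XF → XF → Set
  xx R2 R3 = ⊤
  xx _  _  = ⊥

{-# OPTIONS --safe #-}
-- The first player colours the centre x of the grid (middle row, column ⌊n/2⌋ + 1) and then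
-- answers every move v of the opponent with σ v, where σ is a map on the vertices that are neither
-- x nor adjacent to x which never sends v to x, to v itself or to a neighbour of v, is injective
-- and involutive where defined, and transposes adjacency: w ∼ σ v implies σ w ∼ v. The answer is
-- always legal: an opponent's neighbour w of σ v would make the partner σ w, coloured by the first
-- player, a neighbour of the opponent's own move v. Hence the opponent runs out of moves first.
-- All the graphs are induced subgraphs of the triangular lattice ℕ × {0, 1, 2}, and σ comes from
-- a map of the lattice: the half-turn about the centre for T_{n,3}, (b) and (c), a glide
-- reflection for (d), and for (a), (e) and (f) a translation by about n/2 columns, eastwards for
-- the points west of the centre and westwards for the others.

module Submission where

open import Defs
open import Data.Empty using (⊥; ⊥-elim)
open import Data.Fin using (Fin; zero; suc; toℕ; fromℕ; fromℕ<; inject₁; opposite)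
open import Data.Fin.Properties
  using (toℕ-injective; toℕ<n; toℕ-fromℕ; toℕ-fromℕ<; fromℕ<-toℕ; toℕ-inject₁; opposite-prop)
open import Data.List using (List; []; _∷_; map; filter; length; cartesianProduct; upTo)
open import Data.List.Membership.Propositional using (_∈_; _∉_)
open import Data.List.Membership.Propositional.Properties using (∈-map⁺; ∈-map⁻; ∈-cartesianProduct⁺; ∈-upTo⁺)
open import Data.List.Relation.Unary.Any using (here; there)
open import Data.Maybe using (Maybe; just; nothing; maybe; fromMaybe)
open import Data.Nat using (ℕ; zero; suc; _+_; _*_; _∸_; _≤_; _<_; z≤n; s≤s; s≤s⁻¹; _<?_; ⌊_/2⌋; ⌈_/2⌉)
import Data.Nat as ℕ
open import Data.Nat.Divisibility using (_∣_; divides)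
open import Data.Nat.Induction using (<-wellFounded)
open import Data.Nat.Properties hiding (_≟_)
open import Data.Product using (_×_; _,_; proj₁; proj₂; ∃)
open import Data.Product.Properties using (≡-dec)
open import Data.Sum using (_⊎_; inj₁; inj₂; [_,_])
import Data.Sum as Sum
open import Data.Unit using (tt)
open import Function using (_∘_)
open import Induction.WellFounded using (Acc; acc)
open import Relation.Binary.Definitions using (DecidableEquality; tri<; tri≈; tri>)
open import Relation.Binary.PropositionalEquality
  using (_≡_; _≢_; refl; sym; trans; cong; cong₂; subst; module ≡-Reasoning)
open import Relation.Nullary using (¬_; yes; no; ¬?; contradiction)
open import Relation.Nullary.Decidable using (map′)
open import Relation.Unary using (Decidable)

-- Pairing strategies

record PairingStrategy {A : Set} (_~_ : A → A → Set) (D : A → Set) (x : A) (σ : A → A) : Set where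
  field
    σ≢centre     : ∀ {v} → D v → σ v ≢ x
    σ≢self       : ∀ {v} → D v → σ v ≢ v
    ¬adjacent-σ  : ∀ {v} → D v → ¬ v ~ σ v
    σ-involutive : ∀ {v} → D v → D (σ v) → σ (σ v) ≡ v
    σ-injective  : ∀ {v w} → D v → D w → σ v ≡ σ w → v ≡ w
    σ-transposes : ∀ {v w} → D v → D w → w ~ σ v → σ w ~ v

Apart : {A : Set} → (A → A → Set) → A → A → Set
Apart _~_ x v = v ≢ x × ¬ x ~ v

Far : (G : Graph) → V G → V G → Set
Far G = Apart (Adj G)

PairingStrategy-⊆ : ∀ {A : Set} {_~_ : A → A → Set} {D D′ : A → Set} {x σ} →
  (∀ {v} → D′ v → D v) → PairingStrategy _~_ D x σ → PairingStrategy _~_ D′ x σ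
PairingStrategy-⊆ D′⊆D S = record
  { σ≢centre     = σ≢centre ∘ D′⊆D
  ; σ≢self       = σ≢self ∘ D′⊆D
  ; ¬adjacent-σ  = ¬adjacent-σ ∘ D′⊆D
  ; σ-involutive = λ dv dσv → σ-involutive (D′⊆D dv) (D′⊆D dσv)
  ; σ-injective  = λ dv dw → σ-injective (D′⊆D dv) (D′⊆D dw)
  ; σ-transposes = λ dv dw → σ-transposes (D′⊆D dv) (D′⊆D dw)
  }
  where open PairingStrategy S

module _ {A : Set} {P Q : A → Set} (P? : Decidable P) (Q? : Decidable Q) (P⊆Q : ∀ {a} → P a → Q a) where

  filter-length-mono : ∀ as → length (filter P? as) ≤ length (filter Q? as)
  filter-length-mono [] = z≤n
  filter-length-mono (a ∷ as) with P? a | Q? a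
  ... | yes _ | yes _ = s≤s (filter-length-mono as)
  ... | yes p | no ¬q = contradiction (P⊆Q p) ¬q
  ... | no _  | yes _ = m≤n⇒m≤1+n (filter-length-mono as)
  ... | no _  | no _  = filter-length-mono as

  filter-length-strict : ∀ {a as} → a ∈ as → ¬ P a → Q a →
                         length (filter P? as) < length (filter Q? as)
  filter-length-strict {as = a ∷ as} (here refl) ¬p q with P? a | Q? a
  ... | yes p | _     = contradiction p ¬p
  ... | no _  | yes _ = s≤s (filter-length-mono as)
  ... | no _  | no ¬q = contradiction q ¬q
  filter-length-strict {as = b ∷ as} (there a∈) ¬p q with P? b | Q? b
  ... | yes _ | yes _ = s≤s (filter-length-strict a∈ ¬p q)
  ... | yes p | no ¬q = contradiction (P⊆Q p) ¬q
  ... | no _  | yes _ = m≤n⇒m≤1+n (filter-length-strict a∈ ¬p q)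
  ... | no _  | no _  = filter-length-strict a∈ ¬p q

opp-involutive : ∀ p → opp (opp p) ≡ p
opp-involutive left  = refl
opp-involutive right = refl

opp≢ : ∀ p → opp p ≢ p
opp≢ left  ()
opp≢ right ()

opp-or-same : ∀ p q → q ≡ p ⊎ q ≡ opp p
opp-or-same left  left  = inj₁ refl
opp-or-same left  right = inj₂ refl
opp-or-same right left  = inj₂ refl
opp-or-same right right = inj₁ refl

recolour : ∀ {A : Set} {u : A} {p pos} → (u , p) ∈ pos → (u , opp (opp p)) ∈ pos
recolour {p = p} = subst (λ q → (_ , q) ∈ _) (sym (opp-involutive p))

module _ (G : Graph) where
  open Snort G using (Legal; Wins; win; lose)

  far-of-legal : ∀ {x p pos v} → (x , p) ∈ pos → Legal (opp p) pos v → Far G x v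
  far-of-legal {p = p} x∈ (fresh , calm) =
    (λ { refl → fresh p x∈ }) ,
    (λ x~v → calm _ x~v (recolour x∈))

  dominating-vertex-wins : (x : V G) → (∀ v → ¬ Far G x v) → FirstPlayerWin G
  dominating-vertex-wins x ¬far = wins left , wins right
    where
    wins : ∀ p → Wins p []
    wins p = win x ((λ _ ()) , (λ _ _ ())) (lose λ v legal → ⊥-elim (¬far v (far-of-legal (here refl) legal)))

module PairingPlay (G : Graph) (_≟_ : DecidableEquality (V G))
  (vertices : List (V G)) (∈-vertices : ∀ v → v ∈ vertices)
  {x : V G} {σ : V G → V G} (S : PairingStrategy (Adj G) (Far G x) x σ) where

  open Snort G using (Position; Legal; Wins; Loses; win; lose)
  open PairingStrategy S
  open import Data.List.Membership.DecPropositional _≟_ using (_∈?_)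

  uncoloured : Position → ℕ
  uncoloured pos = length (filter (λ v → ¬? (v ∈? map proj₁ pos)) vertices)

  uncoloured-mono : ∀ pos e → uncoloured (e ∷ pos) ≤ uncoloured pos
  uncoloured-mono pos e = filter-length-mono _ _ (λ ∉e∷pos ∈pos → ∉e∷pos (there ∈pos)) vertices

  uncoloured-decreases : ∀ {pos v} q → (∀ q → (v , q) ∉ pos) → uncoloured ((v , q) ∷ pos) < uncoloured pos
  uncoloured-decreases {pos} {v} q fresh =
    filter-length-strict _ _ (λ ∉e∷pos ∈pos → ∉e∷pos (there ∈pos)) (∈-vertices v)
      (λ ∉ → ∉ (here refl)) (λ ∈pos → uncoloured-fresh (∈-map⁻ proj₁ ∈pos))
    where
    uncoloured-fresh : ¬ ∃ λ e → e ∈ pos × v ≡ proj₁ e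
    uncoloured-fresh ((_ , q′) , ∈ , refl) = fresh q′ ∈

  record Invariant (p : Player) (pos : Position) : Set where
    field
      centre   : (x , p) ∈ pos
      answered : ∀ {u} → (u , opp p) ∈ pos → Far G x u × (σ u , p) ∈ pos
      paired   : ∀ {u} → (u , p) ∈ pos → u ≡ x ⊎ ∃ λ w → (w , opp p) ∈ pos × u ≡ σ w

  module Reply {p pos v} (I : Invariant p pos) (legal : Legal (opp p) pos v) where
    open Invariant I

    far : Far G x v
    far = far-of-legal G centre legal

    σv-fresh : ∀ q → (σ v , q) ∉ (v , opp p) ∷ pos
    σv-fresh q (here e) = σ≢self far (cong proj₁ e)
    σv-fresh q (there σv∈) with opp-or-same p q
    ... | inj₂ refl = let (far-σv , σσv∈) = answered σv∈ in
                      proj₁ legal p (subst (λ u → (u , p) ∈ pos) (σ-involutive far far-σv) σσv∈)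
    ... | inj₁ refl with paired σv∈
    ...   | inj₁ σv≡x = σ≢centre far σv≡x
    ...   | inj₂ (w , w∈ , σv≡σw) =
              let v≡w = σ-injective far (proj₁ (answered w∈)) σv≡σw in
              proj₁ legal (opp p) (subst (λ u → (u , opp p) ∈ pos) (sym v≡w) w∈)

    σv-calm : ∀ u → Adj G u (σ v) → (u , opp p) ∉ (v , opp p) ∷ pos
    σv-calm u u~σv (here refl) = ¬adjacent-σ far u~σv
    σv-calm u u~σv (there u∈) = let (far-u , σu∈) = answered u∈ in
                                proj₂ legal (σ u) (σ-transposes far far-u u~σv) (recolour σu∈)

    σv-legal : Legal p ((v , opp p) ∷ pos) (σ v)
    σv-legal = σv-fresh , σv-calm

    next : Invariant p ((σ v , p) ∷ (v , opp p) ∷ pos)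
    next = record { centre = there (there centre) ; answered = answered′ ; paired = paired′ }
      where
      pos′ = (σ v , p) ∷ (v , opp p) ∷ pos
      answered′ : ∀ {u} → (u , opp p) ∈ pos′ → Far G x u × (σ u , p) ∈ pos′
      answered′ (here e)            = ⊥-elim (opp≢ p (cong proj₂ e))
      answered′ (there (here refl)) = far , here refl
      answered′ (there (there u∈))  = let (far-u , σu∈) = answered u∈ in far-u , there (there σu∈)
      paired′ : ∀ {u} → (u , p) ∈ pos′ → u ≡ x ⊎ ∃ λ w → (w , opp p) ∈ pos′ × u ≡ σ w
      paired′ (here refl)        = inj₂ (v , there (here refl) , refl)
      paired′ (there (here e))   = ⊥-elim (opp≢ p (sym (cong proj₂ e)))
      paired′ (there (there u∈)) with paired u∈
      ... | inj₁ u≡x = inj₁ u≡x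
      ... | inj₂ (w , w∈ , u≡σw) = inj₂ (w , there (there w∈) , u≡σw)

  opponent-loses : ∀ {p} pos → Acc _<_ (uncoloured pos) → Invariant p pos → Loses (opp p) pos
  opponent-loses {p} pos (acc smaller) I = lose λ v legal →
    let open Reply I legal
        shrinks = ≤-<-trans (uncoloured-mono ((v , opp p) ∷ pos) (σ v , p))
                            (uncoloured-decreases (opp p) (proj₁ legal))
    in subst (λ q → Wins q ((v , opp p) ∷ pos)) (sym (opp-involutive p))
         (win (σ v) σv-legal (opponent-loses _ (smaller shrinks) next))

  strategy-wins : ∀ p → Wins p []
  strategy-wins p = win x ((λ _ ()) , (λ _ _ ())) (opponent-loses _ (<-wellFounded _) start)
    where
    start : Invariant p ((x , p) ∷ [])
    start = record
      { centre   = here refl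
      ; answered = λ { (here e) → ⊥-elim (opp≢ p (cong proj₂ e)) }
      ; paired   = λ { (here refl) → inj₁ refl }
      }

pairing-strategy-wins : (G : Graph) → DecidableEquality (V G) →
  (vertices : List (V G)) → (∀ v → v ∈ vertices) →
  {x : V G} {σ : V G → V G} → PairingStrategy (Adj G) (Far G x) x σ → FirstPlayerWin G
pairing-strategy-wins G _≟_ vertices ∈-vertices S = strategy-wins left , strategy-wins right
  where open PairingPlay G _≟_ vertices ∈-vertices S

-- Pairings of the triangular lattice

Point : Set
Point = ℕ × ℕ

data Step : Point → Point → Set where
  east      : ∀ {a b a′ b′} → a′ ≡ suc a → b′ ≡ b     → Step (a , b) (a′ , b′)
  north     : ∀ {a b a′ b′} → a′ ≡ a     → b′ ≡ suc b → Step (a , b) (a′ , b′)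
  northeast : ∀ {a b a′ b′} → a′ ≡ suc a → b′ ≡ suc b → Step (a , b) (a′ , b′)

Adjacent : Point → Point → Set
Adjacent p q = Step p q ⊎ Step q p

Adjacent-sym : ∀ {p q} → Adjacent p q → Adjacent q p
Adjacent-sym (inj₁ s) = inj₂ s
Adjacent-sym (inj₂ s) = inj₁ s

Step-irreflexive : ∀ {p} → ¬ Step p p
Step-irreflexive (east e _)      = 1+n≢n (sym e)
Step-irreflexive (north _ e)     = 1+n≢n (sym e)
Step-irreflexive (northeast e _) = 1+n≢n (sym e)

Adjacent-irreflexive : ∀ {p} → ¬ Adjacent p p
Adjacent-irreflexive (inj₁ s) = Step-irreflexive s
Adjacent-irreflexive (inj₂ s) = Step-irreflexive s

Step-column : ∀ {a b a′ b′} → Step (a , b) (a′ , b′) → a ≤ a′ × a′ ≤ suc a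
Step-column (east refl _)      = n≤1+n _ , ≤-refl
Step-column (north refl _)     = ≤-refl , n≤1+n _
Step-column (northeast refl _) = n≤1+n _ , ≤-refl

¬Adjacent-distant : ∀ {a b a′ b′} → suc a < a′ → ¬ Adjacent (a , b) (a′ , b′)
¬Adjacent-distant a+1<a′ (inj₁ s) = <⇒≱ a+1<a′ (proj₂ (Step-column s))
¬Adjacent-distant a+1<a′ (inj₂ s) = <⇒≱ (≤-trans (n≤1+n _) a+1<a′) (proj₁ (Step-column s))

Step-+ : ∀ t {a b a′ b′} → Step (a , b) (a′ , b′) → Step (a + t , b) (a′ + t , b′)
Step-+ t (east refl e)      = east refl e
Step-+ t (north refl e)     = north refl e
Step-+ t (northeast refl e) = northeast refl e

Step-∸ : ∀ t {a b a′ b′} → Step (a + t , b) (a′ + t , b′) → Step (a , b) (a′ , b′)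
Step-∸ t {a} {a′ = a′} (east e e′)      = east (+-cancelʳ-≡ t a′ (suc a) e) e′
Step-∸ t {a} {a′ = a′} (north e e′)     = north (+-cancelʳ-≡ t a′ a e) e′
Step-∸ t {a} {a′ = a′} (northeast e e′) = northeast (+-cancelʳ-≡ t a′ (suc a) e) e′

Adjacent-+ : ∀ t {a b a′ b′} → Adjacent (a , b) (a′ , b′) → Adjacent (a + t , b) (a′ + t , b′)
Adjacent-+ t (inj₁ s) = inj₁ (Step-+ t s)
Adjacent-+ t (inj₂ s) = inj₂ (Step-+ t s)

Adjacent-∸ : ∀ t {a b a′ b′} → Adjacent (a + t , b) (a′ + t , b′) → Adjacent (a , b) (a′ , b′)
Adjacent-∸ t (inj₁ s) = inj₁ (Step-∸ t s)
Adjacent-∸ t (inj₂ s) = inj₂ (Step-∸ t s)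

module _ {A : Set} {_~_ : A → A → Set} (Box : A → Set) {x : A} {f : A → A}
  (f-box        : ∀ {p} → Box p → Box (f p))
  (f-involutive : ∀ {p} → Box p → f (f p) ≡ p)
  (f-adjacent   : ∀ {p q} → Box p → Box q → p ~ q → f p ~ f q)
  (nearly-fixed : ∀ {p} → Box p → f p ≡ p ⊎ p ~ f p → p ≡ x ⊎ x ~ p)
  (centre-moves-near : f x ≡ x ⊎ x ~ f x)
  where

  involution-pairing : PairingStrategy _~_ (λ p → Box p × Apart _~_ x p) x f
  involution-pairing = record
    { σ≢centre     = λ { (box , p≢x , ¬x~p) fp≡x →
                         let p≡fx = trans (sym (f-involutive box)) (cong f fp≡x) in
                         [ (λ fx≡x → p≢x (trans p≡fx fx≡x))
                         , (λ x~fx → ¬x~p (subst (x ~_) (sym p≡fx) x~fx)) ] centre-moves-near }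
    ; σ≢self       = λ { (box , p≢x , ¬x~p) fp≡p → [ p≢x , ¬x~p ] (nearly-fixed box (inj₁ fp≡p)) }
    ; ¬adjacent-σ  = λ { (box , p≢x , ¬x~p) p~fp → [ p≢x , ¬x~p ] (nearly-fixed box (inj₂ p~fp)) }
    ; σ-involutive = λ (box , _) _ → f-involutive box
    ; σ-injective  = λ (box-p , _) (box-q , _) fp≡fq →
                       trans (sym (f-involutive box-p)) (trans (cong f fp≡fq) (f-involutive box-q))
    ; σ-transposes = λ (box-p , _) (box-q , _) q~fp →
                       subst (f _ ~_) (f-involutive box-p) (f-adjacent box-q (f-box box-p) q~fp)
    }

middle : ℕ → Point
middle s = ⌈ s /2⌉ , 1

half-unique : ∀ {a n} → a + a ≡ n ⊎ a + a ≡ suc n → a ≡ ⌈ n /2⌉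
half-unique {a} (inj₁ e) = trans (n≡⌈n+n/2⌉ a) (cong ⌈_/2⌉ e)
half-unique {a} (inj₂ e) = trans (n≡⌊n+n/2⌋ a) (cong ⌊_/2⌋ e)

⌈n/2⌉-cases : ∀ n → ⌈ n /2⌉ ≡ ⌊ n /2⌋ ⊎ ⌈ n /2⌉ ≡ suc ⌊ n /2⌋
⌈n/2⌉-cases zero          = inj₁ refl
⌈n/2⌉-cases (suc zero)    = inj₂ refl
⌈n/2⌉-cases (suc (suc n)) = Sum.map (cong suc) (cong suc) (⌈n/2⌉-cases n)

n∸⌈n/2⌉≡⌊n/2⌋ : ∀ n → n ∸ ⌈ n /2⌉ ≡ ⌊ n /2⌋
n∸⌈n/2⌉≡⌊n/2⌋ n = begin
  n ∸ ⌈ n /2⌉                   ≡⟨ cong (_∸ ⌈ n /2⌉) (sym (⌊n/2⌋+⌈n/2⌉≡n n)) ⟩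
  ⌊ n /2⌋ + ⌈ n /2⌉ ∸ ⌈ n /2⌉   ≡⟨ m+n∸n≡m ⌊ n /2⌋ ⌈ n /2⌉ ⟩
  ⌊ n /2⌋                       ∎
  where open ≡-Reasoning

close-points : ∀ {a b d e} → (d , e) ≡ (a , b) ⊎ Adjacent (a , b) (d , e) →
               e ≡ b × (d ≡ a ⊎ d ≡ suc a ⊎ a ≡ suc d) ⊎ (e ≡ suc b ⊎ b ≡ suc e)
close-points (inj₁ refl)                    = inj₁ (refl , inj₁ refl)
close-points (inj₂ (inj₁ (east e e′)))      = inj₁ (e′ , inj₂ (inj₁ e))
close-points (inj₂ (inj₁ (north _ e′)))     = inj₂ (inj₁ e′)
close-points (inj₂ (inj₁ (northeast _ e′))) = inj₂ (inj₁ e′)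
close-points (inj₂ (inj₂ (east e e′)))      = inj₁ (sym e′ , inj₂ (inj₂ e))
close-points (inj₂ (inj₂ (north _ e′)))     = inj₂ (inj₂ e′)
close-points (inj₂ (inj₂ (northeast _ e′))) = inj₂ (inj₂ e′)

mirror-near-half : ∀ {a d s} → d + a ≡ s → d ≡ a ⊎ d ≡ suc a ⊎ a ≡ suc d →
                   a ≡ ⌈ s /2⌉ ⊎ suc a ≡ ⌈ s /2⌉
mirror-near-half     e (inj₁ refl)        = inj₁ (half-unique (inj₁ e))
mirror-near-half {a} e (inj₂ (inj₁ refl)) = inj₂ (half-unique (inj₂ (cong suc (trans (+-suc a a) e))))
mirror-near-half     e (inj₂ (inj₂ refl)) = inj₁ (half-unique (inj₂ (cong suc e)))

near-middle : ∀ {a c} → a ≡ c ⊎ suc a ≡ c → (a , 1) ≡ (c , 1) ⊎ Adjacent (c , 1) (a , 1)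
near-middle (inj₁ refl) = inj₁ refl
near-middle (inj₂ e)    = inj₂ (inj₂ (east (sym e) refl))

InBox : ℕ → Point → Set
InBox s (a , b) = a ≤ s × b ≤ 2

rotate : ℕ → Point → Point
rotate s (a , b) = s ∸ a , 2 ∸ b

2∸b≡b⇒b≡1 : ∀ {b} → b ≤ 2 → 2 ∸ b ≡ b → b ≡ 1
2∸b≡b⇒b≡1 {1} _ _ = refl
2∸b≡b⇒b≡1 {2} _ ()

2∸b≢b±1 : ∀ {b} → b ≤ 2 → ¬ (2 ∸ b ≡ suc b ⊎ b ≡ suc (2 ∸ b))
2∸b≢b±1 {0} _ (inj₁ ())
2∸b≢b±1 {0} _ (inj₂ ())
2∸b≢b±1 {1} _ (inj₁ ())
2∸b≢b±1 {1} _ (inj₂ ())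
2∸b≢b±1 {2} _ (inj₁ ())
2∸b≢b±1 {2} _ (inj₂ ())

module _ (s : ℕ) where

  rotate-box : ∀ {p} → InBox s p → InBox s (rotate s p)
  rotate-box {a , b} _ = m∸n≤m s a , m∸n≤m 2 b

  rotate-involutive : ∀ {p} → InBox s p → rotate s (rotate s p) ≡ p
  rotate-involutive (a≤s , b≤2) = cong₂ _,_ (m∸[m∸n]≡n a≤s) (m∸[m∸n]≡n b≤2)

  rotate-Step : ∀ {p q} → InBox s q → Step p q → Step (rotate s q) (rotate s p)
  rotate-Step (a<s , _)   (east refl refl)      = east (+-∸-assoc 1 a<s) refl
  rotate-Step (_ , b<2)   (north refl refl)     = north refl (+-∸-assoc 1 b<2)
  rotate-Step (a<s , b<2) (northeast refl refl) = northeast (+-∸-assoc 1 a<s) (+-∸-assoc 1 b<2)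

  rotate-adjacent : ∀ {p q} → InBox s p → InBox s q → Adjacent p q → Adjacent (rotate s p) (rotate s q)
  rotate-adjacent _     box-q (inj₁ st) = inj₂ (rotate-Step box-q st)
  rotate-adjacent box-p _     (inj₂ st) = inj₁ (rotate-Step box-p st)

  rotate-nearly-fixed : ∀ {p} → InBox s p → rotate s p ≡ p ⊎ Adjacent p (rotate s p) →
                        p ≡ middle s ⊎ Adjacent (middle s) p
  rotate-nearly-fixed {a , b} (a≤s , b≤2) close with close-points close
  ... | inj₁ (row , columns) rewrite 2∸b≡b⇒b≡1 b≤2 row =
          near-middle (mirror-near-half (m∸n+n≡m a≤s) columns)
  ... | inj₂ rows = ⊥-elim (2∸b≢b±1 b≤2 rows)

  rotate-middle : rotate s (middle s) ≡ middle s ⊎ Adjacent (middle s) (rotate s (middle s))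
  rotate-middle rewrite n∸⌈n/2⌉≡⌊n/2⌋ s with ⌈n/2⌉-cases s
  ... | inj₁ e = inj₁ (cong (_, 1) (sym e))
  ... | inj₂ e = inj₂ (inj₂ (east e refl))

  rotation-pairing : PairingStrategy Adjacent (λ p → InBox s p × Apart Adjacent (middle s) p)
                                     (middle s) (rotate s)
  rotation-pairing = involution-pairing (InBox s) rotate-box rotate-involutive rotate-adjacent
                                        rotate-nearly-fixed rotate-middle

InSlantedBox : ℕ → Point → Set
InSlantedBox s (a , b) = a ≤ b + s × b ≤ 2

-- Mirrors row b about column (b + s)/2, turning north steps into northeast steps and vice versa.
glide : ℕ → Point → Point
glide s (a , b) = b + s ∸ a , b

module _ (s : ℕ) where

  glide-box : ∀ {p} → InSlantedBox s p → InSlantedBox s (glide s p)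
  glide-box {a , b} (_ , b≤2) = m∸n≤m (b + s) a , b≤2

  glide-involutive : ∀ {p} → InSlantedBox s p → glide s (glide s p) ≡ p
  glide-involutive (a≤b+s , _) = cong (_, _) (m∸[m∸n]≡n a≤b+s)

  glide-Step : ∀ {p q} → InSlantedBox s p → InSlantedBox s q → Step p q → Adjacent (glide s p) (glide s q)
  glide-Step _          (a<b+s , _) (east refl refl)      = inj₂ (east (+-∸-assoc 1 a<b+s) refl)
  glide-Step (a≤b+s , _) _          (north refl refl)     = inj₁ (northeast (+-∸-assoc 1 a≤b+s) refl)
  glide-Step _          _           (northeast refl refl) = inj₁ (north refl refl)

  glide-adjacent : ∀ {p q} → InSlantedBox s p → InSlantedBox s q →
                   Adjacent p q → Adjacent (glide s p) (glide s q)
  glide-adjacent box-p box-q (inj₁ st) = glide-Step box-p box-q st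
  glide-adjacent box-p box-q (inj₂ st) = Adjacent-sym (glide-Step box-q box-p st)

  glide-nearly-fixed : ∀ {p} → InSlantedBox s p → glide s p ≡ p ⊎ Adjacent p (glide s p) →
                       p ≡ middle s ⊎ Adjacent (middle s) p
  glide-nearly-fixed {a , b} (a≤b+s , b≤2) close with close-points close
  ... | inj₁ (_ , columns)  = near-glide-middle b≤2 (mirror-near-half (m∸n+n≡m a≤b+s) columns)
    where
    near-glide-middle : ∀ {a b} → b ≤ 2 → a ≡ ⌈ b + s /2⌉ ⊎ suc a ≡ ⌈ b + s /2⌉ →
                        (a , b) ≡ middle s ⊎ Adjacent (middle s) (a , b)
    near-glide-middle {b = 0} _ (inj₁ e) = inj₂ (inj₂ (north (sym e) refl))
    near-glide-middle {b = 0} _ (inj₂ e) = inj₂ (inj₂ (northeast (sym e) refl))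
    near-glide-middle {b = 1} _ half with ⌈n/2⌉-cases s | half
    ... | inj₁ c≡⌊⌋   | inj₁ e = inj₂ (inj₁ (east (trans e (cong suc (sym c≡⌊⌋))) refl))
    ... | inj₁ c≡⌊⌋   | inj₂ e = inj₁ (cong (_, 1) (trans (suc-injective e) (sym c≡⌊⌋)))
    ... | inj₂ c≡1+⌊⌋ | inj₁ e = inj₁ (cong (_, 1) (trans e (sym c≡1+⌊⌋)))
    ... | inj₂ c≡1+⌊⌋ | inj₂ e = inj₂ (inj₂ (east (trans c≡1+⌊⌋ (sym e)) refl))
    near-glide-middle {b = 2} _ (inj₁ e) = inj₂ (inj₁ (northeast e refl))
    near-glide-middle {b = 2} _ (inj₂ e) = inj₂ (inj₁ (north (suc-injective e) refl))
    near-glide-middle {b = suc (suc (suc _))} (s≤s (s≤s ())) _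
  ... | inj₂ (inj₁ e) = ⊥-elim (1+n≢n (sym e))
  ... | inj₂ (inj₂ e) = ⊥-elim (1+n≢n (sym e))

  glide-middle : glide s (middle s) ≡ middle s ⊎ Adjacent (middle s) (glide s (middle s))
  glide-middle rewrite +-∸-assoc 1 (⌈n/2⌉≤n s) | n∸⌈n/2⌉≡⌊n/2⌋ s with ⌈n/2⌉-cases s
  ... | inj₁ e = inj₂ (inj₁ (east (cong suc (sym e)) refl))
  ... | inj₂ e = inj₁ (cong (_, 1) (sym e))

  glide-pairing : PairingStrategy Adjacent (λ p → InSlantedBox s p × Apart Adjacent (middle s) p)
                                  (middle s) (glide s)
  glide-pairing = involution-pairing (InSlantedBox s) glide-box glide-involutive glide-adjacent
                                     glide-nearly-fixed glide-middle

-- Opaque, so that goals mentioning shift can be rewritten with shift-west and shift-east.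
opaque
  shift : ℕ → ℕ → Point → Point
  shift c t (a , b) with a <? c
  ... | yes _ = a + t , b
  ... | no _  = a ∸ t , b

  shift-west : ∀ {c a} t b → a < c → shift c t (a , b) ≡ (a + t , b)
  shift-west {c} {a} _ _ a<c with a <? c
  ... | yes _   = refl
  ... | no a≮c = contradiction a<c a≮c

  shift-east : ∀ {c r} t b → c < r + t → shift c t (r + t , b) ≡ (r , b)
  shift-east {c} {r} t _ c<r+t with r + t <? c
  ... | yes r+t<c = contradiction r+t<c (<-asym c<r+t)
  ... | no _      = cong (_, _) (m+n∸n≡m r t)

-- A point west of column c moves t columns east, any other point t columns west; a translate
-- may land in column c next to the centre (c , 1), but not on it.
data Half (c t : ℕ) : Point → Set where
  in-west : ∀ {a b} → a < c → c ≤ a + t → (a + t ≡ c → b ≡ 0) → Half c t (a , b)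
  in-east : ∀ {r b} → c < r + t → r ≤ c → (r ≡ c → b ≡ 2) → Half c t (r + t , b)

Half-off-centre : ∀ {c t b} → ¬ Half c t (c , b)
Half-off-centre (in-west c<c _ _) = <-irrefl refl c<c
Half-off-centre (in-east c<c _ _) = <-irrefl refl c<c

Translatable : (c t : ℕ) → (Point → Set) → Point → Set
Translatable c t Q p = Half c t p × Q (shift c t p)

centre-column-near : ∀ {c b} → b ≤ 2 → ¬ Apart Adjacent (c , 1) (c , b)
centre-column-near {b = 0} _ (_ , ¬adj) = ¬adj (inj₂ (north refl refl))
centre-column-near {b = 1} _ (≢ , _)    = ≢ refl
centre-column-near {b = 2} _ (_ , ¬adj) = ¬adj (inj₁ (north refl refl))
centre-column-near {b = suc (suc (suc _))} (s≤s (s≤s ())) _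

west-of-centre : ∀ {a b c} → suc a ≡ c → b ≤ 2 → Apart Adjacent (c , 1) (a , b) → b ≡ 2
west-of-centre {b = 0} refl _ (_ , ¬adj) = ⊥-elim (¬adj (inj₂ (northeast refl refl)))
west-of-centre {b = 1} refl _ (_ , ¬adj) = ⊥-elim (¬adj (inj₂ (east refl refl)))
west-of-centre {b = 2} refl _ _          = refl
west-of-centre {b = suc (suc (suc _))} _ (s≤s (s≤s ())) _

east-of-centre : ∀ {a b c} → a ≡ suc c → b ≤ 2 → Apart Adjacent (c , 1) (a , b) → b ≡ 0
east-of-centre {b = 0} refl _ _          = refl
east-of-centre {b = 1} refl _ (_ , ¬adj) = ⊥-elim (¬adj (inj₁ (east refl refl)))
east-of-centre {b = 2} refl _ (_ , ¬adj) = ⊥-elim (¬adj (inj₁ (northeast refl refl)))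
east-of-centre {b = suc (suc (suc _))} _ (s≤s (s≤s ())) _

module Translation (c t : ℕ) (2≤t : 2 ≤ t) {P : Point → Set}
  (far   : ∀ {p} → P p → Apart Adjacent (c , 1) p)
  (row≤2 : ∀ {a b} → P (a , b) → b ≤ 2)
  (half  : ∀ {p} → P p → Half c t p)
  where

  a+t≢a : ∀ a → a + t ≢ a
  a+t≢a a e = <-irrefl (sym e) (m<m+n a (≤-trans (s≤s z≤n) 2≤t))

  ¬Adjacent-shifted : ∀ {a b b′} → ¬ Adjacent (a , b) (a + t , b′)
  ¬Adjacent-shifted {a} = ¬Adjacent-distant (subst (_≤ a + t) (+-comm a 2) (+-monoʳ-≤ a 2≤t))

  west-image≢east-image : ∀ {a b r b′} → c ≤ a → (a ≡ c → b ≡ 0) → r ≤ c → (r ≡ c → b′ ≡ 2) →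
                          (a , b) ≢ (r , b′)
  west-image≢east-image c≤a row r≤c row′ refl with row (≤-antisym r≤c c≤a)
  ... | refl with row′ (≤-antisym r≤c c≤a)
  ... | ()

  -- A western point next to a western translate can only be (c ∸ 1 , 0), a neighbour of the centre.
  west-west : ∀ {a b a′ b′} → a′ < c → c ≤ a → (a ≡ c → b ≡ 0) →
              Adjacent (a′ , b′) (a , b) → Adjacent (c , 1) (a′ , b′)
  west-west a′<c c≤a row (inj₁ (east refl refl)) with ≤-antisym a′<c c≤a
  ... | refl with row refl
  ... | refl = inj₂ (northeast refl refl)
  west-west a′<c c≤a row (inj₁ (north refl refl))     = ⊥-elim (<⇒≱ a′<c c≤a)
  west-west a′<c c≤a row (inj₁ (northeast refl refl)) with row (≤-antisym a′<c c≤a)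
  ... | ()
  west-west a′<c c≤a row (inj₂ (east refl refl))      = ⊥-elim (<⇒≱ a′<c (≤-trans c≤a (n≤1+n _)))
  west-west a′<c c≤a row (inj₂ (north refl refl))     = ⊥-elim (<⇒≱ a′<c c≤a)
  west-west a′<c c≤a row (inj₂ (northeast refl refl)) = ⊥-elim (<⇒≱ a′<c (≤-trans c≤a (n≤1+n _)))

  -- Likewise, an eastern point next to an eastern translate can only be (c + 1 , 2).
  east-east : ∀ {a′ b′ r b} → c < a′ → b′ ≤ 2 → r ≤ c → (r ≡ c → b ≡ 2) →
              Adjacent (a′ , b′) (r , b) → Adjacent (c , 1) (a′ , b′)
  east-east c<a′ _ r≤c row (inj₂ (east refl refl)) with ≤-antisym r≤c (≤-pred c<a′)
  ... | refl with row refl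
  ... | refl = inj₁ (northeast refl refl)
  east-east c<a′ b′≤2 r≤c row (inj₂ (northeast refl refl)) with row (≤-antisym r≤c (≤-pred c<a′))
  east-east c<a′ (s≤s (s≤s ())) r≤c row (inj₂ (northeast refl refl)) | refl
  east-east c<a′ _ r≤c row (inj₂ (north refl refl))  = ⊥-elim (<⇒≱ c<a′ r≤c)
  east-east c<a′ _ r≤c row (inj₁ (east refl refl))      = ⊥-elim (<⇒≱ c<a′ (≤-trans (n≤1+n _) r≤c))
  east-east c<a′ _ r≤c row (inj₁ (north refl refl))     = ⊥-elim (<⇒≱ c<a′ r≤c)
  east-east c<a′ _ r≤c row (inj₁ (northeast refl refl)) = ⊥-elim (<⇒≱ c<a′ (≤-trans (n≤1+n _) r≤c))

  translation-pairing : PairingStrategy Adjacent P (c , 1) (shift c t)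
  translation-pairing = record
    { σ≢centre     = σ≢centre
    ; σ≢self       = σ≢self
    ; ¬adjacent-σ  = ¬adjacent-σ
    ; σ-involutive = σ-involutive
    ; σ-injective  = σ-injective
    ; σ-transposes = σ-transposes
    }
    where
    σ≢centre : ∀ {p} → P p → shift c t p ≢ (c , 1)
    σ≢centre pp with half pp
    ... | in-west {b = b} a<c _ row rewrite shift-west t b a<c = λ { refl → contradiction (row refl) λ () }
    ... | in-east {b = b} c<r+t _ row rewrite shift-east t b c<r+t = λ { refl → contradiction (row refl) λ () }

    σ≢self : ∀ {p} → P p → shift c t p ≢ p
    σ≢self pp with half pp
    ... | in-west {b = b} a<c _ _ rewrite shift-west t b a<c = λ e → a+t≢a _ (cong proj₁ e)
    ... | in-east {b = b} c<r+t _ _ rewrite shift-east t b c<r+t = λ e → a+t≢a _ (sym (cong proj₁ e))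

    ¬adjacent-σ : ∀ {p} → P p → ¬ Adjacent p (shift c t p)
    ¬adjacent-σ pp with half pp
    ... | in-west {b = b} a<c _ _ rewrite shift-west t b a<c = ¬Adjacent-shifted
    ... | in-east {b = b} c<r+t _ _ rewrite shift-east t b c<r+t = ¬Adjacent-shifted ∘ Adjacent-sym

    σ-involutive : ∀ {p} → P p → P (shift c t p) → shift c t (shift c t p) ≡ p
    σ-involutive pp with half pp
    ... | in-west {a} {b} a<c c≤a+t _ rewrite shift-west t b a<c = λ pσ →
          shift-east t b (≤∧≢⇒< c≤a+t λ c≡a+t →
            Half-off-centre (subst (λ a → Half c t (a , b)) (sym c≡a+t) (half pσ)))
    ... | in-east {b = b} c<r+t r≤c _ rewrite shift-east t b c<r+t = λ pσ →
          shift-west t b (≤∧≢⇒< r≤c (λ { refl → Half-off-centre (half pσ) }))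

    σ-injective : ∀ {p q} → P p → P q → shift c t p ≡ shift c t q → p ≡ q
    σ-injective pp pq with half pp | half pq
    ... | in-west {b = b} a<c _ _ | in-west {b = b′} a′<c _ _
        rewrite shift-west t b a<c | shift-west t b′ a′<c =
          λ e → cong₂ _,_ (+-cancelʳ-≡ t _ _ (cong proj₁ e)) (cong proj₂ e)
    ... | in-west {b = b} a<c c≤a+t row | in-east {b = b′} c<r+t r≤c row′
        rewrite shift-west t b a<c | shift-east t b′ c<r+t =
          ⊥-elim ∘ west-image≢east-image c≤a+t row r≤c row′
    ... | in-east {b = b} c<r+t r≤c row | in-west {b = b′} a<c c≤a+t row′
        rewrite shift-east t b c<r+t | shift-west t b′ a<c =
          ⊥-elim ∘ west-image≢east-image c≤a+t row′ r≤c row ∘ sym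
    ... | in-east {b = b} c<r+t _ _ | in-east {b = b′} c<r′+t _ _
        rewrite shift-east t b c<r+t | shift-east t b′ c<r′+t =
          λ { refl → refl }

    σ-transposes : ∀ {p q} → P p → P q → Adjacent q (shift c t p) → Adjacent (shift c t q) p
    σ-transposes pp pq with half pp | half pq
    ... | in-west {b = b} a<c c≤a+t row | in-west a′<c _ _ rewrite shift-west t b a<c =
          ⊥-elim ∘ proj₂ (far pq) ∘ west-west a′<c c≤a+t row
    ... | in-west {b = b} a<c _ _ | in-east {b = b′} c<r+t _ _
        rewrite shift-west t b a<c | shift-east t b′ c<r+t = Adjacent-∸ t
    ... | in-east {b = b} c<r+t _ _ | in-west {b = b′} a<c _ _
        rewrite shift-east t b c<r+t | shift-west t b′ a<c = Adjacent-+ t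
    ... | in-east {b = b} c<r+t r≤c row | in-east c<r′+t _ _ rewrite shift-east t b c<r+t =
          ⊥-elim ∘ proj₂ (far pq) ∘ east-east c<r′+t (row≤2 pq) r≤c row

-- Graphs embedded in the lattice

record LatticeEmbedding (G : Graph) : Set where
  field
    coord        : V G → Point
    decode       : Point → V G
    decode-coord : ∀ v → decode (coord v) ≡ v
    width        : ℕ
    column≤      : ∀ v → proj₁ (coord v) ≤ width
    row≤         : ∀ v → proj₂ (coord v) ≤ 2
    adjacent⁺    : ∀ {u v} → Adj G u v → Adjacent (coord u) (coord v)
    adjacent⁻    : ∀ {u v} → Adjacent (coord u) (coord v) → Adj G u v

  coord-injective : ∀ {u v} → coord u ≡ coord v → u ≡ v
  coord-injective {u} {v} e = trans (sym (decode-coord u)) (trans (cong decode e) (decode-coord v))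

  _≟_ : DecidableEquality (V G)
  u ≟ v = map′ coord-injective (cong coord) (≡-dec ℕ._≟_ ℕ._≟_ (coord u) (coord v))

  vertices : List (V G)
  vertices = map decode (cartesianProduct (upTo (suc width)) (upTo 3))

  ∈-vertices : ∀ v → v ∈ vertices
  ∈-vertices v = subst (_∈ vertices) (decode-coord v)
    (∈-map⁺ decode (∈-cartesianProduct⁺ (∈-upTo⁺ (s≤s (column≤ v))) (∈-upTo⁺ (s≤s (row≤ v)))))

  FarImage : V G → Point → Set
  FarImage x p = ∃ λ v → Far G x v × coord v ≡ p

  far-image-far : ∀ {x p} → FarImage x p → Apart Adjacent (coord x) p
  far-image-far (v , (v≢x , ¬x~v) , refl) = v≢x ∘ coord-injective , ¬x~v ∘ adjacent⁻

  Occupied : Point → Set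
  Occupied p = ∃ λ w → coord w ≡ p

  lattice-pairing-wins : (x : V G) {f : Point → Point} →
    PairingStrategy Adjacent (FarImage x) (coord x) f →
    (∀ {p} → FarImage x p → Occupied (f p)) →
    FirstPlayerWin G
  lattice-pairing-wins x {f} S occupied = pairing-strategy-wins G _≟_ vertices ∈-vertices T
    where
    module S = PairingStrategy S
    σ : V G → V G
    σ = decode ∘ f ∘ coord

    image : ∀ {v} → Far G x v → FarImage x (coord v)
    image far = _ , far , refl

    coord-σ : ∀ {v} → Far G x v → coord (σ v) ≡ f (coord v)
    coord-σ far with occupied (image far)
    ... | w , coord-w≡ rewrite sym coord-w≡ = cong coord (decode-coord w)

    T : PairingStrategy (Adj G) (Far G x) x σ
    T = record
      { σ≢centre     = λ far σv≡x → S.σ≢centre (image far) (trans (sym (coord-σ far)) (cong coord σv≡x))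
      ; σ≢self       = λ far σv≡v → S.σ≢self (image far) (trans (sym (coord-σ far)) (cong coord σv≡v))
      ; ¬adjacent-σ  = λ far v~σv → S.¬adjacent-σ (image far) (subst (Adjacent _) (coord-σ far) (adjacent⁺ v~σv))
      ; σ-involutive = λ {v} far far-σv → coord-injective (begin
          coord (σ (σ v))     ≡⟨ coord-σ far-σv ⟩
          f (coord (σ v))     ≡⟨ cong f (coord-σ far) ⟩
          f (f (coord v))     ≡⟨ S.σ-involutive (image far) (σ v , far-σv , coord-σ far) ⟩
          coord v             ∎)
      ; σ-injective  = λ far-v far-w σv≡σw → coord-injective (S.σ-injective (image far-v) (image far-w)
          (trans (sym (coord-σ far-v)) (trans (cong coord σv≡σw) (coord-σ far-w))))
      ; σ-transposes = λ far-v far-w w~σv → adjacent⁻ (subst (λ p → Adjacent p _) (sym (coord-σ far-w))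
          (S.σ-transposes (image far-v) (image far-w) (subst (Adjacent _) (coord-σ far-v) (adjacent⁺ w~σv))))
      }
      where open ≡-Reasoning

  symmetry-wins : (x : V G) {c : Point} {Box : Point → Set} {f : Point → Point} → coord x ≡ c →
    PairingStrategy Adjacent (λ p → Box p × Apart Adjacent c p) c f →
    (∀ v → Box (coord v)) → (∀ v → Apart Adjacent c (coord v) → Occupied (f (coord v))) →
    FirstPlayerWin G
  symmetry-wins x refl S in-box occupied =
    lattice-pairing-wins x (PairingStrategy-⊆ (λ { far@(v , _ , refl) → in-box v , far-image-far far }) S)
                           (λ { far@(v , _ , refl) → occupied v (far-image-far far) })

  translation-wins : (x : V G) {c t : ℕ} → coord x ≡ (c , 1) → 2 ≤ t →
    (∀ v → Apart Adjacent (c , 1) (coord v) → Translatable c t Occupied (coord v)) →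
    FirstPlayerWin G
  translation-wins x {c} {t} x↦c 2≤t translatable =
    lattice-pairing-wins x
      (subst (λ z → PairingStrategy Adjacent (FarImage x) z (shift c t)) (sym x↦c) translation-pairing)
                           (λ { far@(v , _ , refl) → proj₂ (translatable v (apart far)) })
    where
    apart : ∀ {p} → FarImage x p → Apart Adjacent (c , 1) p
    apart far = subst (λ z → Apart Adjacent z _) x↦c (far-image-far far)
    image-row≤ : ∀ {a b} → FarImage x (a , b) → b ≤ 2
    image-row≤ (v , _ , refl) = row≤ v
    image-half : ∀ {p} → FarImage x p → Half c t p
    image-half far@(v , _ , refl) = proj₁ (translatable v (apart far))
    open Translation c t 2≤t apart image-row≤ image-half

-- Grid cell (i , j) sits at column i + 1, leaving column 0 for the vertices L₁, L₂.
cell : ∀ {n} → Grid n → Point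
cell (i , j) = suc (toℕ i) , toℕ j

uncell : ∀ n → Point → Maybe (Grid n)
uncell n (zero , b) = nothing
uncell n (suc a , b) with a <? n | b <? 3
... | yes a<n | yes b<3 = just (fromℕ< a<n , fromℕ< b<3)
... | yes _   | no _    = nothing
... | no _    | _       = nothing

module _ {n : ℕ} where

  uncell-cell : ∀ (g : Grid n) → uncell n (cell g) ≡ just g
  uncell-cell (i , j) with toℕ i <? n | toℕ j <? 3
  ... | yes i<n | yes j<3 = cong just (cong₂ _,_ (fromℕ<-toℕ i i<n) (fromℕ<-toℕ j j<3))
  ... | yes _   | no j≮3  = contradiction (toℕ<n j) j≮3
  ... | no i≮n  | _       = contradiction (toℕ<n i) i≮n

  uncell-beyond : ∀ {a b} → n ≤ a → uncell n (suc a , b) ≡ nothing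
  uncell-beyond {a} {b} n≤a with a <? n | b <? 3
  ... | yes a<n | yes _ = contradiction a<n (≤⇒≯ n≤a)
  ... | yes _   | no _  = refl
  ... | no _    | _     = refl

  cell-at : ∀ {a b} → 0 < a → a ≤ n → b ≤ 2 → ∃ λ (g : Grid n) → cell g ≡ (a , b)
  cell-at {suc a} _ a<n b≤2 =
    (fromℕ< a<n , fromℕ< (s≤s b≤2)) , cong₂ _,_ (cong suc (toℕ-fromℕ< a<n)) (toℕ-fromℕ< (s≤s b≤2))

  cell-column≤ : ∀ (g : Grid n) → proj₁ (cell g) ≤ n
  cell-column≤ (i , _) = toℕ<n i

  cell-row≤ : ∀ (g : Grid n) → proj₂ (cell g) ≤ 2
  cell-row≤ (_ , j) = s≤s⁻¹ (toℕ<n j)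

  GridEdge⇒Step : ∀ {g h : Grid n} → GridEdge g h → Step (cell g) (cell h)
  GridEdge⇒Step (inj₁ (e , refl))        = east (cong suc e) refl
  GridEdge⇒Step (inj₂ (inj₁ (refl , e))) = north refl e
  GridEdge⇒Step (inj₂ (inj₂ (e , e′)))   = northeast (cong suc e) e′

  Step⇒GridEdge : ∀ {g h : Grid n} → Step (cell g) (cell h) → GridEdge g h
  Step⇒GridEdge (east e e′)      = inj₁ (suc-injective e , toℕ-injective e′)
  Step⇒GridEdge (north e e′)     = inj₂ (inj₁ (toℕ-injective (suc-injective e) , e′))
  Step⇒GridEdge (northeast e e′) = inj₂ (inj₂ (suc-injective e , e′))

  grid-adjacent⁺ : ∀ {g h : Grid n} → GridEdge g h ⊎ GridEdge h g → Adjacent (cell g) (cell h)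
  grid-adjacent⁺ (inj₁ e) = inj₁ (GridEdge⇒Step e)
  grid-adjacent⁺ (inj₂ e) = inj₂ (GridEdge⇒Step e)

  grid-adjacent⁻ : ∀ {g h : Grid n} → Adjacent (cell g) (cell h) → GridEdge g h ⊎ GridEdge h g
  grid-adjacent⁻ (inj₁ s) = inj₁ (Step⇒GridEdge s)
  grid-adjacent⁻ (inj₂ s) = inj₂ (Step⇒GridEdge s)

T3-embedding : ∀ m → LatticeEmbedding (T3 (suc m))
T3-embedding m = record
  { coord        = cell
  ; decode       = fromMaybe (zero , zero) ∘ uncell (suc m)
  ; decode-coord = cong (fromMaybe (zero , zero)) ∘ uncell-cell
  ; width        = suc m
  ; column≤      = cell-column≤
  ; row≤         = cell-row≤
  ; adjacent⁺    = grid-adjacent⁺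
  ; adjacent⁻    = grid-adjacent⁻
  }

centre-cell : ∀ m → Grid (suc m)
centre-cell m = fromℕ< (⌊n/2⌋<n m) , suc zero

cell-centre : ∀ m → cell (centre-cell m) ≡ middle (suc (suc m))
cell-centre m = cong (λ a → suc a , 1) (toℕ-fromℕ< (⌊n/2⌋<n m))

record Placement (m : ℕ) (X : Set) (XG : X → Grid (suc m) → Set) (XX : X → X → Set) : Set where
  field
    place         : X → Point
    recover       : Point → X
    recover-place : ∀ y → recover (place y) ≡ y
    off-grid      : ∀ y → uncell (suc m) (place y) ≡ nothing
    column≤       : ∀ y → proj₁ (place y) ≤ 3 + m
    row≤          : ∀ y → proj₂ (place y) ≤ 2
    attach⁺       : ∀ {y g} → XG y g → Adjacent (place y) (cell g)
    attach⁻       : ∀ {y g} → Adjacent (place y) (cell g) → XG y g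
    link⁺         : ∀ {y z} → XX y z → Adjacent (place y) (place z)
    link⁻         : ∀ {y z} → Adjacent (place y) (place z) → XX y z ⊎ XX z y

extend-embedding : ∀ {m X XG XX} → Placement m X XG XX → LatticeEmbedding (Extend (suc m) X XG XX)
extend-embedding {m} {X} {XG} {XX} P = record
  { coord        = coord
  ; decode       = decode
  ; decode-coord = decode-coord
  ; width        = 3 + m
  ; column≤      = λ { (inj₁ g) → ≤-trans (cell-column≤ g) (m≤n+m (suc m) 2) ; (inj₂ y) → column≤ y }
  ; row≤         = λ { (inj₁ g) → cell-row≤ g ; (inj₂ y) → row≤ y }
  ; adjacent⁺    = λ {u} {v} → adjacent⁺ {u} {v}
  ; adjacent⁻    = λ {u} {v} → adjacent⁻ {u} {v}
  }
  where
  open Placement P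
  G = Extend (suc m) X XG XX

  coord : V G → Point
  coord (inj₁ g) = cell g
  coord (inj₂ y) = place y

  decode : Point → V G
  decode p = maybe inj₁ (inj₂ (recover p)) (uncell (suc m) p)

  decode-coord : ∀ v → decode (coord v) ≡ v
  decode-coord (inj₁ g) = cong (maybe inj₁ _) (uncell-cell g)
  decode-coord (inj₂ y) = trans (cong (maybe inj₁ _) (off-grid y)) (cong inj₂ (recover-place y))

  adjacent⁺ : ∀ {u v} → Adj G u v → Adjacent (coord u) (coord v)
  adjacent⁺ {inj₁ _} {inj₁ _} e        = grid-adjacent⁺ e
  adjacent⁺ {inj₁ _} {inj₂ _} (inj₂ e) = Adjacent-sym (attach⁺ e)
  adjacent⁺ {inj₂ _} {inj₁ _} (inj₁ e) = attach⁺ e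
  adjacent⁺ {inj₂ _} {inj₂ _} (inj₁ e) = link⁺ e
  adjacent⁺ {inj₂ _} {inj₂ _} (inj₂ e) = Adjacent-sym (link⁺ e)

  adjacent⁻ : ∀ {u v} → Adjacent (coord u) (coord v) → Adj G u v
  adjacent⁻ {inj₁ _} {inj₁ _} a = grid-adjacent⁻ a
  adjacent⁻ {inj₁ _} {inj₂ _} a = inj₂ (attach⁻ (Adjacent-sym a))
  adjacent⁻ {inj₂ _} {inj₁ _} a = inj₁ (attach⁻ a)
  adjacent⁻ {inj₂ _} {inj₂ _} a = link⁻ a

-- The extra vertices at (0 , j) and at (n + 1 , j + 1) are joined to the end cells of rows j, j + 1.
module _ {m : ℕ} {j : Fin 2} where

  west-port⁺ : ∀ {g : Grid (suc m)} → g ≡ first (inject₁ j) ⊎ g ≡ first (suc j) →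
               Adjacent (0 , toℕ j) (cell g)
  west-port⁺ (inj₁ refl) = inj₁ (east refl (toℕ-inject₁ j))
  west-port⁺ (inj₂ refl) = inj₁ (northeast refl refl)

  west-port⁻ : ∀ {g : Grid (suc m)} → Adjacent (0 , toℕ j) (cell g) →
               g ≡ first (inject₁ j) ⊎ g ≡ first (suc j)
  west-port⁻ {zero , k} (inj₁ (east _ e)) =
    inj₁ (cong (zero ,_) (toℕ-injective (trans e (sym (toℕ-inject₁ j)))))
  west-port⁻ {zero , k} (inj₁ (northeast _ e)) = inj₂ (cong (zero ,_) (toℕ-injective e))
  west-port⁻ {suc _ , _} (inj₁ (east () _))
  west-port⁻ {suc _ , _} (inj₁ (northeast () _))
  west-port⁻ (inj₂ (east () _))
  west-port⁻ (inj₂ (north () _))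
  west-port⁻ (inj₂ (northeast () _))

  last-column : ∀ {i : Fin (suc m)} → toℕ i ≡ m → i ≡ fromℕ m
  last-column e = toℕ-injective (trans e (sym (toℕ-fromℕ m)))

  east-port⁺ : ∀ {g : Grid (suc m)} → g ≡ last (inject₁ j) ⊎ g ≡ last (suc j) →
               Adjacent (2 + m , suc (toℕ j)) (cell g)
  east-port⁺ (inj₁ refl) = inj₂ (northeast (cong (2 +_) (sym (toℕ-fromℕ m))) (cong suc (sym (toℕ-inject₁ j))))
  east-port⁺ (inj₂ refl) = inj₂ (east (cong (2 +_) (sym (toℕ-fromℕ m))) refl)

  east-port⁻ : ∀ {g : Grid (suc m)} → Adjacent (2 + m , suc (toℕ j)) (cell g) →
               g ≡ last (inject₁ j) ⊎ g ≡ last (suc j)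
  east-port⁻ {i , k} (inj₂ (northeast e e′)) =
    inj₁ (cong₂ _,_ (last-column (sym (suc-injective (suc-injective e))))
                    (toℕ-injective (trans (sym (suc-injective e′)) (sym (toℕ-inject₁ j)))))
  east-port⁻ {i , k} (inj₂ (east e e′)) =
    inj₂ (cong₂ _,_ (last-column (sym (suc-injective (suc-injective e)))) (toℕ-injective (sym e′)))
  east-port⁻ {i , _} (inj₂ (north e _)) = ⊥-elim (<-irrefl (sym (suc-injective e)) (toℕ<n i))
  east-port⁻ {i , _} (inj₁ s)           = ⊥-elim (<⇒≱ (toℕ<n i) (s≤s⁻¹ (proj₁ (Step-column s))))

-- The half-turn and glide cases: T_{n,3}, (b), (c), (d)

cell-opposite : ∀ {m} (g : Grid (suc m)) →
                cell (opposite (proj₁ g) , opposite (proj₂ g)) ≡ rotate (2 + m) (cell g)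
cell-opposite (i , j) =
  cong₂ _,_ (trans (cong suc (opposite-prop i)) (sym (+-∸-assoc 1 (s≤s⁻¹ (toℕ<n i))))) (opposite-prop j)

cell-in-box : ∀ {m} (g : Grid (suc m)) → InBox (2 + m) (cell g)
cell-in-box g = ≤-trans (cell-column≤ g) (n≤1+n _) , cell-row≤ g

T3-wins : ∀ m → FirstPlayerWin (T3 (suc m))
T3-wins m = symmetry-wins (centre-cell m) (cell-centre m) (rotation-pairing (2 + m)) cell-in-box
              (λ g _ → _ , cell-opposite g)
  where open LatticeEmbedding (T3-embedding m)

west≁east : ∀ {m b b′} → ¬ Adjacent (0 , b) (2 + m , b′)
west≁east = ¬Adjacent-distant (s≤s (s≤s z≤n))

B-embedding : ∀ m → LatticeEmbedding (GB m)
B-embedding m = extend-embedding record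
  { place = place ; recover = recover ; recover-place = λ { L1 → refl ; R3 → refl }
  ; off-grid = λ { L1 → refl ; R3 → uncell-beyond ≤-refl }
  ; column≤ = λ { L1 → z≤n ; R3 → n≤1+n _ } ; row≤ = λ { L1 → z≤n ; R3 → ≤-refl }
  ; attach⁺ = λ { {L1} → west-port⁺ ; {R3} → east-port⁺ }
  ; attach⁻ = λ { {L1} → west-port⁻ ; {R3} → east-port⁻ }
  ; link⁺ = λ () ; link⁻ = link⁻
  }
  where
  place : XB → Point
  place L1 = 0 , 0
  place R3 = 2 + m , 2
  recover : Point → XB
  recover (zero , _)  = L1
  recover (suc _ , _) = R3
  link⁻ : ∀ {y z} → Adjacent (place y) (place z) → ⊥ ⊎ ⊥
  link⁻ {L1} {L1} a = ⊥-elim (Adjacent-irreflexive a)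
  link⁻ {L1} {R3} a = ⊥-elim (west≁east a)
  link⁻ {R3} {L1} a = ⊥-elim (west≁east (Adjacent-sym a))
  link⁻ {R3} {R3} a = ⊥-elim (Adjacent-irreflexive a)

B-wins : ∀ m → FirstPlayerWin (GB m)
B-wins m = symmetry-wins (inj₁ (centre-cell m)) (cell-centre m) (rotation-pairing (2 + m)) in-box occupied
  where
  open LatticeEmbedding (B-embedding m)
  in-box : ∀ v → InBox (2 + m) (coord v)
  in-box (inj₁ g)  = cell-in-box g
  in-box (inj₂ L1) = z≤n , z≤n
  in-box (inj₂ R3) = ≤-refl , ≤-refl
  occupied : ∀ v → Apart Adjacent (middle (2 + m)) (coord v) → Occupied (rotate (2 + m) (coord v))
  occupied (inj₁ g)  _ = inj₁ _ , cell-opposite g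
  occupied (inj₂ L1) _ = inj₂ R3 , refl
  occupied (inj₂ R3) _ = inj₂ L1 , cong (_, 0) (sym (n∸n≡0 (2 + m)))

C-embedding : ∀ m → LatticeEmbedding (GC m)
C-embedding m = extend-embedding record
  { place = place ; recover = recover
  ; recover-place = λ { L1 → refl ; L2 → refl ; R2 → refl ; R3 → refl }
  ; off-grid = λ { L1 → refl ; L2 → refl ; R2 → uncell-beyond ≤-refl ; R3 → uncell-beyond ≤-refl }
  ; column≤ = λ { L1 → z≤n ; L2 → z≤n ; R2 → n≤1+n _ ; R3 → n≤1+n _ }
  ; row≤ = λ { L1 → z≤n ; L2 → s≤s z≤n ; R2 → s≤s z≤n ; R3 → ≤-refl }
  ; attach⁺ = λ { {L1} → west-port⁺ ; {L2} → west-port⁺ ; {R2} → east-port⁺ ; {R3} → east-port⁺ }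
  ; attach⁻ = λ { {L1} → west-port⁻ ; {L2} → west-port⁻ ; {R2} → east-port⁻ ; {R3} → east-port⁻ }
  ; link⁺ = link⁺ ; link⁻ = link⁻
  }
  where
  place : XC → Point
  place L1 = 0 , 0
  place L2 = 0 , 1
  place R2 = 2 + m , 1
  place R3 = 2 + m , 2
  recover : Point → XC
  recover (zero , zero)          = L1
  recover (zero , suc _)         = L2
  recover (suc _ , suc (suc _))  = R3
  recover (suc _ , _)            = R2
  link⁺ : ∀ {y z} → Edge (GC m) (inj₂ y) (inj₂ z) → Adjacent (place y) (place z)
  link⁺ {L1} {L2} _ = inj₁ (north refl refl)
  link⁺ {R2} {R3} _ = inj₁ (north refl refl)
  link⁻ : ∀ {y z} → Adjacent (place y) (place z) → Edge (GC m) (inj₂ y) (inj₂ z) ⊎ Edge (GC m) (inj₂ z) (inj₂ y)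
  link⁻ {L1} {L2} _ = inj₁ tt
  link⁻ {L2} {L1} _ = inj₂ tt
  link⁻ {R2} {R3} _ = inj₁ tt
  link⁻ {R3} {R2} _ = inj₂ tt
  link⁻ {L1} {L1} a = ⊥-elim (Adjacent-irreflexive a)
  link⁻ {L2} {L2} a = ⊥-elim (Adjacent-irreflexive a)
  link⁻ {R2} {R2} a = ⊥-elim (Adjacent-irreflexive a)
  link⁻ {R3} {R3} a = ⊥-elim (Adjacent-irreflexive a)
  link⁻ {L1} {R2} a = ⊥-elim (west≁east a)
  link⁻ {L1} {R3} a = ⊥-elim (west≁east a)
  link⁻ {L2} {R2} a = ⊥-elim (west≁east a)
  link⁻ {L2} {R3} a = ⊥-elim (west≁east a)
  link⁻ {R2} {L1} a = ⊥-elim (west≁east (Adjacent-sym a))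
  link⁻ {R2} {L2} a = ⊥-elim (west≁east (Adjacent-sym a))
  link⁻ {R3} {L1} a = ⊥-elim (west≁east (Adjacent-sym a))
  link⁻ {R3} {L2} a = ⊥-elim (west≁east (Adjacent-sym a))

C-wins : ∀ m → FirstPlayerWin (GC m)
C-wins m = symmetry-wins (inj₁ (centre-cell m)) (cell-centre m) (rotation-pairing (2 + m)) in-box occupied
  where
  open LatticeEmbedding (C-embedding m)
  in-box : ∀ v → InBox (2 + m) (coord v)
  in-box (inj₁ g)  = cell-in-box g
  in-box (inj₂ L1) = z≤n , z≤n
  in-box (inj₂ L2) = z≤n , s≤s z≤n
  in-box (inj₂ R2) = ≤-refl , s≤s z≤n
  in-box (inj₂ R3) = ≤-refl , ≤-refl
  occupied : ∀ v → Apart Adjacent (middle (2 + m)) (coord v) → Occupied (rotate (2 + m) (coord v))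
  occupied (inj₁ g)  _ = inj₁ _ , cell-opposite g
  occupied (inj₂ L1) _ = inj₂ R3 , refl
  occupied (inj₂ L2) _ = inj₂ R2 , refl
  occupied (inj₂ R2) _ = inj₂ L2 , cong (_, 1) (sym (n∸n≡0 (2 + m)))
  occupied (inj₂ R3) _ = inj₂ L1 , cong (_, 0) (sym (n∸n≡0 (2 + m)))

cell-from-east : ∀ {m k b} → k ≤ m → b ≤ 2 → ∃ λ (g : Grid (suc m)) → cell g ≡ (suc m ∸ k , b)
cell-from-east {m} {k} {b} k≤m b≤2 =
  let (g , cell-g) = cell-at (s≤s z≤n) (s≤s (m∸n≤m m k)) b≤2 in
  g , trans cell-g (cong (_, b) (sym (+-∸-assoc 1 k≤m)))

D-embedding : ∀ m → LatticeEmbedding (GD m)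
D-embedding m = extend-embedding record
  { place = place ; recover = recover
  ; recover-place = λ { R2 → cong (λ k → pick k 1) (n∸n≡0 (2 + m))
                      ; R3 → cong (λ k → pick k 2) (n∸n≡0 (2 + m))
                      ; R3' → cong (λ k → pick k 2) (m+n∸n≡m 1 (2 + m)) }
  ; off-grid = λ { R2 → uncell-beyond ≤-refl ; R3 → uncell-beyond ≤-refl ; R3' → uncell-beyond (n≤1+n _) }
  ; column≤ = λ { R2 → n≤1+n _ ; R3 → n≤1+n _ ; R3' → ≤-refl }
  ; row≤ = λ { R2 → s≤s z≤n ; R3 → ≤-refl ; R3' → ≤-refl }
  ; attach⁺ = λ { {R2} → east-port⁺ ; {R3} → east-port⁺ ; {R3'} () }
  ; attach⁻ = λ { {R2} → east-port⁻ ; {R3} → east-port⁻ ; {R3'} {i , _} a → ⊥-elim (beyond i a) }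
  ; link⁺ = link⁺ ; link⁻ = link⁻
  }
  where
  beyond : ∀ (i : Fin (suc m)) {j b} → ¬ Adjacent (3 + m , b) (cell (i , j))
  beyond i a = ¬Adjacent-distant (s≤s (s≤s (s≤s (s≤s⁻¹ (toℕ<n i))))) (Adjacent-sym a)
  place : XD → Point
  place R2  = 2 + m , 1
  place R3  = 2 + m , 2
  place R3' = 3 + m , 2
  pick : ℕ → ℕ → XD
  pick zero (suc (suc _)) = R3
  pick zero _             = R2
  pick (suc _) _          = R3'
  recover : Point → XD
  recover (a , b) = pick (a ∸ (2 + m)) b
  link⁺ : ∀ {y z} → Edge (GD m) (inj₂ y) (inj₂ z) → Adjacent (place y) (place z)
  link⁺ {R2} {R3}  _ = inj₁ (north refl refl)
  link⁺ {R2} {R3'} _ = inj₁ (northeast refl refl)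
  link⁺ {R3} {R3'} _ = inj₁ (east refl refl)
  link⁻ : ∀ {y z} → Adjacent (place y) (place z) → Edge (GD m) (inj₂ y) (inj₂ z) ⊎ Edge (GD m) (inj₂ z) (inj₂ y)
  link⁻ {R2}  {R3}  _ = inj₁ tt
  link⁻ {R2}  {R3'} _ = inj₁ tt
  link⁻ {R3}  {R3'} _ = inj₁ tt
  link⁻ {R3}  {R2}  _ = inj₂ tt
  link⁻ {R3'} {R2}  _ = inj₂ tt
  link⁻ {R3'} {R3}  _ = inj₂ tt
  link⁻ {R2}  {R2}  a = ⊥-elim (Adjacent-irreflexive a)
  link⁻ {R3}  {R3}  a = ⊥-elim (Adjacent-irreflexive a)
  link⁻ {R3'} {R3'} a = ⊥-elim (Adjacent-irreflexive a)

D-R3-mirror : ∀ m → Apart Adjacent (middle (2 + m)) (2 + m , 2) → ∃ λ (g : Grid (suc m)) → cell g ≡ (2 , 2)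
D-R3-mirror zero    (_ , ¬adj) = ⊥-elim (¬adj (inj₁ (northeast refl refl)))
D-R3-mirror (suc m) _          = (suc zero , suc (suc zero)) , refl

D-wins : ∀ m → FirstPlayerWin (GD m)
D-wins m = symmetry-wins x (cell-centre m) (glide-pairing (2 + m)) in-box occupied
  where
  open LatticeEmbedding (D-embedding m)
  x = inj₁ (centre-cell m)
  in-box : ∀ v → InSlantedBox (2 + m) (coord v)
  in-box (inj₁ (i , j)) = ≤-trans (toℕ<n i) (≤-trans (n≤1+n _) (m≤n+m _ (toℕ j))) , cell-row≤ (i , j)
  in-box (inj₂ R2)      = n≤1+n _ , s≤s z≤n
  in-box (inj₂ R3)      = m≤n+m _ 2 , ≤-refl
  in-box (inj₂ R3')     = n≤1+n _ , ≤-refl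
  occupied : ∀ v → Apart Adjacent (middle (2 + m)) (coord v) → Occupied (glide (2 + m) (coord v))
  occupied (inj₁ (i , zero)) _ = let (g , e) = cell-from-east (s≤s⁻¹ (toℕ<n i)) z≤n in inj₁ g , e
  occupied (inj₁ (zero , suc zero)) _ = inj₂ R2 , refl
  occupied (inj₁ (suc i , suc zero)) _ = let (g , e) = cell-from-east (<⇒≤ (toℕ<n i)) (s≤s z≤n) in inj₁ g , e
  occupied (inj₁ (zero , suc (suc zero))) _ = inj₂ R3' , refl
  occupied (inj₁ (suc zero , suc (suc zero))) _ = inj₂ R3 , refl
  occupied (inj₁ (suc (suc i) , suc (suc zero))) _ =
    let (g , e) = cell-from-east (≤-trans (<⇒≤ (toℕ<n i)) (n≤1+n _)) ≤-refl in inj₁ g , e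
  occupied (inj₂ R2) _ = inj₁ (zero , suc zero) , cong (_, 1) (sym (m+n∸n≡m 1 (2 + m)))
  occupied (inj₂ R3') _ = inj₁ (zero , suc (suc zero)) , cong (_, 2) (sym (m+n∸n≡m 1 (3 + m)))
  occupied (inj₂ R3) far =
    let (g , e) = D-R3-mirror m far in inj₁ g , trans e (cong (_, 2) (sym (m+n∸n≡m 2 (2 + m))))

-- The translation cases: (a), (e), (f)

⌊n/2⌋-parity : ∀ n → n ≡ ⌊ n /2⌋ + ⌊ n /2⌋ ⊎ n ≡ suc (⌊ n /2⌋ + ⌊ n /2⌋)
⌊n/2⌋-parity zero          = inj₁ refl
⌊n/2⌋-parity (suc zero)    = inj₂ refl
⌊n/2⌋-parity (suc (suc n)) with ⌊n/2⌋-parity n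
... | inj₁ e = inj₁ (cong suc (trans (cong suc e) (sym (+-suc ⌊ n /2⌋ ⌊ n /2⌋))))
... | inj₂ e = inj₂ (cong suc (trans (cong suc e) (cong suc (sym (+-suc ⌊ n /2⌋ ⌊ n /2⌋)))))

⌊n/2⌋+⌊n/2⌋≤n : ∀ n → ⌊ n /2⌋ + ⌊ n /2⌋ ≤ n
⌊n/2⌋+⌊n/2⌋≤n n =
  subst (⌊ n /2⌋ + ⌊ n /2⌋ ≤_) (⌊n/2⌋+⌈n/2⌉≡n n) (+-monoʳ-≤ ⌊ n /2⌋ (⌊n/2⌋≤⌈n/2⌉ n))

n≤⌈n/2⌉+⌈n/2⌉ : ∀ n → n ≤ ⌈ n /2⌉ + ⌈ n /2⌉
n≤⌈n/2⌉+⌈n/2⌉ n =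
  subst (_≤ ⌈ n /2⌉ + ⌈ n /2⌉) (⌊n/2⌋+⌈n/2⌉≡n n) (+-monoˡ-≤ ⌈ n /2⌉ (⌊n/2⌋≤⌈n/2⌉ n))

⌊n/2⌋+⌈1+n/2⌉≤1+n : ∀ n → ⌊ n /2⌋ + ⌈ suc n /2⌉ ≤ suc n
⌊n/2⌋+⌈1+n/2⌉≤1+n n = subst (_≤ suc n) (sym (+-suc ⌊ n /2⌋ ⌊ n /2⌋)) (s≤s (⌊n/2⌋+⌊n/2⌋≤n n))

-- For n = m + 1 columns, centre column c = ⌊n/2⌋ + 1 and a shift t ∈ {c, c + 1}, the translates
-- of the points apart from the centre land on grid cells, on (n + 1 , 2) (the vertex R₃) or on
-- (0 , 0) (the vertex L₁).
module Translates (m t : ℕ) {Q : Point → Set}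
  (c≤t       : ⌈ 2 + m /2⌉ ≤ t)
  (t≤c+1     : t ≤ suc ⌈ 2 + m /2⌉)
  (west-fits : ⌊ suc m /2⌋ + t ≤ 2 + m)
  (Q-cell    : ∀ (g : Grid (suc m)) → Q (cell g))
  (Q-east    : Q (2 + m , 2))
  (Q-west    : t ≡ suc ⌈ 2 + m /2⌉ → Q (0 , 0))
  where

  h c : ℕ
  h = ⌊ suc m /2⌋
  c = ⌈ 2 + m /2⌉

  c≤n : c ≤ suc m
  c≤n = ⌊n/2⌋<n m

  2+m≤c+t : 2 + m ≤ c + t
  2+m≤c+t = ≤-trans (n≤⌈n/2⌉+⌈n/2⌉ (2 + m)) (+-monoʳ-≤ c c≤t)

  translate-on-centre : ∀ {a} → a + t ≡ c → a ≡ 0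
  translate-on-centre {zero}  _ = refl
  translate-on-centre {suc a} e = ⊥-elim (<-irrefl (sym e) (s≤s (≤-trans c≤t (m≤n+m t a))))

  west-point : ∀ {a b} → a < c → b ≤ 2 → (a ≡ 0 → b ≡ 0) → Apart Adjacent (c , 1) (a , b) →
               Translatable c t Q (a , b)
  west-point {a} {b} a<c b≤2 origin apart =
    in-west a<c c≤a+t (origin ∘ translate-on-centre) , subst Q (sym (shift-west t b a<c)) image
    where
    c≤a+t : c ≤ a + t
    c≤a+t = ≤-trans c≤t (m≤n+m t a)
    a≤h : a ≤ h
    a≤h = s≤s⁻¹ a<c
    image : Q (a + t , b)
    image with m≤n⇒m<n∨m≡n (≤-trans (+-monoˡ-≤ t a≤h) west-fits)
    ... | inj₁ a+t<2+m =
          let (g , e) = cell-at (≤-trans (s≤s z≤n) c≤a+t) (s≤s⁻¹ a+t<2+m) b≤2 in subst Q e (Q-cell g)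
    ... | inj₂ a+t≡2+m = subst Q (cong₂ _,_ (sym a+t≡2+m) (sym b≡2)) Q-east
      where
      a≡h : a ≡ h
      a≡h = ≤-antisym a≤h (+-cancelʳ-≤ t h a (≤-trans west-fits (≤-reflexive (sym a+t≡2+m))))
      b≡2 : b ≡ 2
      b≡2 = west-of-centre (cong suc a≡h) b≤2 apart

  east-point : ∀ {a b} → c < a → a ≤ 2 + m → (a ≡ c + t → b ≡ 2) → b ≤ 2 → Apart Adjacent (c , 1) (a , b) →
               Translatable c t Q (a , b)
  east-point {a} {b} c<a a≤2+m row b≤2 apart =
    subst (λ z → Half c t (z , b)) r+t≡a (in-east (subst (c <_) (sym r+t≡a) c<a) r≤c (row ∘ a≡c+t)) ,
    subst Q (sym shift≡) image
    where
    t≤a : t ≤ a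
    t≤a = ≤-trans t≤c+1 c<a
    r+t≡a : a ∸ t + t ≡ a
    r+t≡a = m∸n+n≡m t≤a
    r≤c : a ∸ t ≤ c
    r≤c = m≤n+o⇒m∸n≤o a t (≤-trans a≤2+m (subst (2 + m ≤_) (+-comm c t) 2+m≤c+t))
    a≡c+t : a ∸ t ≡ c → a ≡ c + t
    a≡c+t r≡c = trans (sym r+t≡a) (cong (_+ t) r≡c)
    shift≡ : shift c t (a , b) ≡ (a ∸ t , b)
    shift≡ = subst (λ z → shift c t (z , b) ≡ (a ∸ t , b)) r+t≡a
                   (shift-east t b (subst (c <_) (sym r+t≡a) c<a))
    image : Q (a ∸ t , b)
    image with a ∸ t in r≡
    ... | suc r =
          let (g , e) = cell-at (s≤s z≤n) (≤-trans (subst (_≤ c) r≡ r≤c) c≤n) b≤2 in subst Q e (Q-cell g)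
    ... | zero  = subst Q (cong (0 ,_) (sym b≡0)) (Q-west t≡c+1)
      where
      a≡t : a ≡ t
      a≡t = ≤-antisym (m∸n≡0⇒m≤n r≡) t≤a
      t≡c+1 : t ≡ suc c
      t≡c+1 = ≤-antisym t≤c+1 (subst (suc c ≤_) a≡t c<a)
      b≡0 : b ≡ 0
      b≡0 = east-of-centre (trans a≡t t≡c+1) b≤2 apart

  grid-point : ∀ g → Apart Adjacent (c , 1) (cell g) → Translatable c t Q (cell g)
  grid-point (i , j) apart with <-cmp (suc (toℕ i)) c
  ... | tri< a<c _ _ = west-point a<c (cell-row≤ (i , j)) (λ ()) apart
  ... | tri≈ _ a≡c _ =
          ⊥-elim (centre-column-near (cell-row≤ (i , j)) (subst (λ a → Apart Adjacent (c , 1) (a , toℕ j)) a≡c apart))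
  ... | tri> _ _ c<a = east-point c<a (≤-trans (toℕ<n i) (n≤1+n _)) (⊥-elim ∘ short) (cell-row≤ (i , j)) apart
    where
    short : suc (toℕ i) ≢ c + t
    short e = <-irrefl e (<-≤-trans (s≤s (toℕ<n i)) 2+m≤c+t)

module TranslatesByCentre (m : ℕ) {Q : Point → Set} =
  Translates m ⌈ 2 + m /2⌉ {Q} ≤-refl (n≤1+n _) (⌊n/2⌋+⌈1+n/2⌉≤1+n (suc m))

E-embedding : ∀ m → LatticeEmbedding (GE m)
E-embedding m = extend-embedding record
  { place = λ { R3 → 2 + m , 2 } ; recover = λ _ → R3 ; recover-place = λ { R3 → refl }
  ; off-grid = λ { R3 → uncell-beyond ≤-refl } ; column≤ = λ { R3 → n≤1+n _ } ; row≤ = λ { R3 → ≤-refl }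
  ; attach⁺ = λ { {R3} → east-port⁺ } ; attach⁻ = λ { {R3} → east-port⁻ }
  ; link⁺ = λ () ; link⁻ = λ { {R3} {R3} a → ⊥-elim (Adjacent-irreflexive a) }
  }

E-wins : ∀ m → FirstPlayerWin (GE m)
E-wins zero = dominating-vertex-wins (GE 0) x (λ v far → near v (far-image-far (v , far , refl)))
  where
  open LatticeEmbedding (E-embedding 0)
  x = inj₁ (centre-cell 0)
  near : ∀ v → ¬ Apart Adjacent (1 , 1) (coord v)
  near (inj₁ (zero , j)) = centre-column-near (cell-row≤ {1} (zero , j))
  near (inj₂ R3) (_ , ¬adj) = ¬adj (inj₁ (northeast refl refl))
E-wins (suc m) =
  translation-wins (inj₁ (centre-cell (suc m))) (cell-centre (suc m)) (s≤s (s≤s z≤n)) translatable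
  where
  open LatticeEmbedding (E-embedding (suc m))
  open TranslatesByCentre (suc m) {Occupied} (λ g → inj₁ g , refl) (inj₂ R3 , refl) (⊥-elim ∘ 1+n≢n ∘ sym)
  translatable : ∀ v → Apart Adjacent (c , 1) (coord v) → Translatable c c Occupied (coord v)
  translatable (inj₁ g)  = grid-point g
  translatable (inj₂ R3) = east-point (s≤s c≤n) ≤-refl (λ _ → refl) ≤-refl

F-embedding : ∀ m → LatticeEmbedding (GF m)
F-embedding m = extend-embedding record
  { place = place ; recover = recover ; recover-place = λ { R2 → refl ; R3 → refl }
  ; off-grid = λ { R2 → uncell-beyond ≤-refl ; R3 → uncell-beyond ≤-refl }
  ; column≤ = λ { R2 → n≤1+n _ ; R3 → n≤1+n _ } ; row≤ = λ { R2 → s≤s z≤n ; R3 → ≤-refl }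
  ; attach⁺ = λ { {R2} → east-port⁺ ; {R3} → east-port⁺ } ; attach⁻ = λ { {R2} → east-port⁻ ; {R3} → east-port⁻ }
  ; link⁺ = link⁺ ; link⁻ = link⁻
  }
  where
  place : XF → Point
  place R2 = 2 + m , 1
  place R3 = 2 + m , 2
  recover : Point → XF
  recover (_ , suc (suc _)) = R3
  recover _                 = R2
  link⁺ : ∀ {y z} → Edge (GF m) (inj₂ y) (inj₂ z) → Adjacent (place y) (place z)
  link⁺ {R2} {R3} _ = inj₁ (north refl refl)
  link⁻ : ∀ {y z} → Adjacent (place y) (place z) → Edge (GF m) (inj₂ y) (inj₂ z) ⊎ Edge (GF m) (inj₂ z) (inj₂ y)
  link⁻ {R2} {R3} _ = inj₁ tt
  link⁻ {R3} {R2} _ = inj₂ tt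
  link⁻ {R2} {R2} a = ⊥-elim (Adjacent-irreflexive a)
  link⁻ {R3} {R3} a = ⊥-elim (Adjacent-irreflexive a)

even⇒⌊n/2⌋+⌊n/2⌋ : ∀ {n} → 2 ∣ n → n ≡ ⌊ n /2⌋ + ⌊ n /2⌋
even⇒⌊n/2⌋+⌊n/2⌋ {n} (divides q n≡q*2) with ⌊n/2⌋-parity n
... | inj₁ even = even
... | inj₂ odd  = ⊥-elim (even≢odd q h (begin
  2 * q               ≡⟨ *-comm 2 q ⟩
  q * 2               ≡⟨ sym n≡q*2 ⟩
  n                   ≡⟨ odd ⟩
  suc (h + h)         ≡⟨ cong (λ k → suc (h + k)) (sym (+-identityʳ h)) ⟩
  suc (2 * h)         ∎))
  where
  h = ⌊ n /2⌋
  open ≡-Reasoning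

even⇒1+n<⌈1+n/2⌉+⌈1+n/2⌉ : ∀ {n} → n ≡ ⌊ n /2⌋ + ⌊ n /2⌋ → suc n < ⌈ suc n /2⌉ + ⌈ suc n /2⌉
even⇒1+n<⌈1+n/2⌉+⌈1+n/2⌉ {n} even = s≤s (≤-reflexive (trans (cong suc even) (sym (+-suc ⌊ n /2⌋ ⌊ n /2⌋))))

F-wins : ∀ m → 2 ∣ suc m → FirstPlayerWin (GF m)
F-wins zero 2∣1 with even⇒⌊n/2⌋+⌊n/2⌋ 2∣1
... | ()
F-wins (suc m) 2∣n =
  translation-wins (inj₁ (centre-cell (suc m))) (cell-centre (suc m)) (s≤s (s≤s z≤n)) translatable
  where
  open LatticeEmbedding (F-embedding (suc m))
  open TranslatesByCentre (suc m) {Occupied} (λ g → inj₁ g , refl) (inj₂ R3 , refl) (⊥-elim ∘ 1+n≢n ∘ sym)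
  translatable : ∀ v → Apart Adjacent (c , 1) (coord v) → Translatable c c Occupied (coord v)
  translatable (inj₁ g)  = grid-point g
  translatable (inj₂ R2) = east-point (s≤s c≤n) ≤-refl (⊥-elim ∘ short) (s≤s z≤n)
    where
    short : 2 + suc m ≢ c + c
    short e = <-irrefl e (even⇒1+n<⌈1+n/2⌉+⌈1+n/2⌉ (even⇒⌊n/2⌋+⌊n/2⌋ 2∣n))
  translatable (inj₂ R3) = east-point (s≤s c≤n) ≤-refl (λ _ → refl) ≤-refl

A-embedding : ∀ m → LatticeEmbedding (GA m)
A-embedding m = extend-embedding record
  { place = place ; recover = recover ; recover-place = λ { L1 → refl ; R2 → refl ; R3 → refl }
  ; off-grid = λ { L1 → refl ; R2 → uncell-beyond ≤-refl ; R3 → uncell-beyond ≤-refl }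
  ; column≤ = λ { L1 → z≤n ; R2 → n≤1+n _ ; R3 → n≤1+n _ } ; row≤ = λ { L1 → z≤n ; R2 → s≤s z≤n ; R3 → ≤-refl }
  ; attach⁺ = λ { {L1} → west-port⁺ ; {R2} → east-port⁺ ; {R3} → east-port⁺ }
  ; attach⁻ = λ { {L1} → west-port⁻ ; {R2} → east-port⁻ ; {R3} → east-port⁻ }
  ; link⁺ = link⁺ ; link⁻ = link⁻
  }
  where
  place : XA → Point
  place L1 = 0 , 0
  place R2 = 2 + m , 1
  place R3 = 2 + m , 2
  recover : Point → XA
  recover (zero , _)           = L1
  recover (suc _ , suc (suc _)) = R3
  recover (suc _ , _)          = R2
  link⁺ : ∀ {y z} → Edge (GA m) (inj₂ y) (inj₂ z) → Adjacent (place y) (place z)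
  link⁺ {R2} {R3} _ = inj₁ (north refl refl)
  link⁻ : ∀ {y z} → Adjacent (place y) (place z) → Edge (GA m) (inj₂ y) (inj₂ z) ⊎ Edge (GA m) (inj₂ z) (inj₂ y)
  link⁻ {R2} {R3} _ = inj₁ tt
  link⁻ {R3} {R2} _ = inj₂ tt
  link⁻ {L1} {L1} a = ⊥-elim (Adjacent-irreflexive a)
  link⁻ {R2} {R2} a = ⊥-elim (Adjacent-irreflexive a)
  link⁻ {R3} {R3} a = ⊥-elim (Adjacent-irreflexive a)
  link⁻ {L1} {R2} a = ⊥-elim (west≁east a)
  link⁻ {L1} {R3} a = ⊥-elim (west≁east a)
  link⁻ {R2} {L1} a = ⊥-elim (west≁east (Adjacent-sym a))
  link⁻ {R3} {L1} a = ⊥-elim (west≁east (Adjacent-sym a))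

A-translation-wins : ∀ m t → ⌈ 2 + m /2⌉ ≤ t → t ≤ suc ⌈ 2 + m /2⌉ → ⌊ suc m /2⌋ + t ≤ 2 + m → 2 ≤ t →
                     2 + m < ⌈ 2 + m /2⌉ + t → FirstPlayerWin (GA m)
A-translation-wins m t c≤t t≤c+1 west-fits 2≤t short =
  translation-wins (inj₁ (centre-cell m)) (cell-centre m) 2≤t translatable
  where
  open LatticeEmbedding (A-embedding m)
  open Translates m t {Occupied} c≤t t≤c+1 west-fits (λ g → inj₁ g , refl) (inj₂ R3 , refl)
                  (λ _ → inj₂ L1 , refl)
  translatable : ∀ v → Apart Adjacent (c , 1) (coord v) → Translatable c t Occupied (coord v)
  translatable (inj₁ g)  = grid-point g
  translatable (inj₂ L1) = west-point (s≤s z≤n) z≤n (λ _ → refl)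
  translatable (inj₂ R2) = east-point (s≤s c≤n) ≤-refl (λ e → ⊥-elim (<-irrefl e short)) (s≤s z≤n)
  translatable (inj₂ R3) = east-point (s≤s c≤n) ≤-refl (λ _ → refl) ≤-refl

A-wins : ∀ m → FirstPlayerWin (GA m)
A-wins m with ⌊n/2⌋-parity (suc m)
A-wins zero    | inj₁ ()
A-wins (suc m) | inj₁ even = A-translation-wins (suc m) _ ≤-refl (n≤1+n _) (⌊n/2⌋+⌈1+n/2⌉≤1+n (2 + m))
                               (s≤s (s≤s z≤n)) (even⇒1+n<⌈1+n/2⌉+⌈1+n/2⌉ even)
A-wins m       | inj₂ odd  = A-translation-wins m _ (n≤1+n _) ≤-refl odd-fits (s≤s (s≤s z≤n))
                               (subst (2 + m <_) (sym (+-suc c c)) (s≤s (n≤⌈n/2⌉+⌈n/2⌉ (2 + m))))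
  where
  h = ⌊ suc m /2⌋
  c = ⌈ 2 + m /2⌉
  odd-fits : h + suc (suc h) ≤ 2 + m
  odd-fits = ≤-reflexive (trans (+-suc h (suc h)) (cong suc (trans (+-suc h h) (cong suc (sym (suc-injective odd))))))

theorem3p8 : (m : ℕ) →
      FirstPlayerWin (T3 (suc m))
    × FirstPlayerWin (GA m)
    × FirstPlayerWin (GB m)
    × FirstPlayerWin (GC m)
    × FirstPlayerWin (GD m)
    × FirstPlayerWin (GE m)
    × (2 ∣ suc m → FirstPlayerWin (GF m))
theorem3p8 m = T3-wins m , A-wins m , B-wins m , C-wins m , D-wins m , E-wins m , F-wins m
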